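{- In the pure bang calculus $(\Lambda_!, \to_{!\beta})$, for all terms $T,S$: if $T\to_{!\beta}^* S$ then $T\to_{\ell\ell,!\beta}^*\cdot\to_{\neg\ell\ell,!\beta}^* S$.
   Context: Pure bang terms: $T ::= x\mid\lambda x.T\mid TS\mid !T$ (set $\Lambda_!$), contexts $C ::= [\cdot]\mid\lambda x.C\mid TC\mid CT\mid !C$. $\to_{!\beta}$ is the contextual closure of $(\lambda x.T)\,!S\mapsto_{!\beta}T[S/x]$. Level: $\mathrm{lev}([\cdot])=0$, $\mathrm{lev}(!C)=\mathrm{lev}(C)+1$, unchanged under $\lambda$ and application. $\mathrm{ll}(T)=\inf\{\mathrm{lev}(C)\mid T=C[R], R\text{ a }!\beta\text{ -redex}\}$. A step $C[R]\to_{!\beta}C[R']$ is least-level ($\to_{\ell\ell,!\beta}$) if $\mathrm{lev}(C)=\mathrm{ll}(C[R])$ and internal ($\to_{\neg\ell\ell,!\beta}$) if $\mathrm{lev}(C)>\mathrm{ll}(C[R])$. -}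

module Defs where

open import Data.Nat using (ℕ; zero; suc; _<_)
open import Data.Product using (Σ; ∃; _×_; _,_)
open import Data.Empty using (⊥)
open import Relation.Binary.PropositionalEquality using (_≡_)
open import Relation.Binary.Construct.Closure.ReflexiveTransitive using (Star)

-- Pure bang terms, variables as de Bruijn indices (terms up to α-equivalence).
data Term : Set where
  var : ℕ → Term
  lam : Term → Term
  app : Term → Term → Term
  bang : Term → Term

Ren : Set
Ren = ℕ → ℕ

extR : Ren → Ren
extR ρ zero = zero
extR ρ (suc n) = suc (ρ n)

rename : Ren → Term → Term
rename ρ (var n) = var (ρ n)
rename ρ (lam t) = lam (rename (extR ρ) t)
rename ρ (app t s) = app (rename ρ t) (rename ρ s)
rename ρ (bang t) = bang (rename ρ t)

Sub : Set
Sub = ℕ → Term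

extS : Sub → Sub
extS σ zero = var zero
extS σ (suc n) = rename suc (σ n)

subst : Sub → Term → Term
subst σ (var n) = σ n
subst σ (lam t) = lam (subst (extS σ) t)
subst σ (app t s) = app (subst σ t) (subst σ s)
subst σ (bang t) = bang (subst σ t)

-- single substitution T[S/x] where x is the variable bound by the outer λ (index 0)
single : Term → Sub
single s zero = s
single s (suc n) = var n

_[_/0] : Term → Term → Term
t [ s /0] = subst (single s) t

data RootStep : Term → Term → Set where
  !β : ∀ t s → RootStep (app (lam t) (bang s)) (t [ s /0])

IsRedex : Term → Set
IsRedex r = ∃ λ r' → RootStep r r'

data Ctx : Set where
  hole : Ctx
  lamC : Ctx → Ctx
  appR : Term → Ctx → Ctx
  appL : Ctx → Term → Ctx
  bangC : Ctx → Ctx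

plug : Ctx → Term → Term
plug hole r = r
plug (lamC c) r = lam (plug c r)
plug (appR t c) r = app t (plug c r)
plug (appL c t) r = app (plug c r) t
plug (bangC c) r = bang (plug c r)

lev : Ctx → ℕ
lev hole = 0
lev (lamC c) = lev c
lev (appR t c) = lev c
lev (appL c t) = lev c
lev (bangC c) = suc (lev c)

RedexAt : Term → ℕ → Set
RedexAt t n = Σ Ctx λ c → Σ Term λ r → IsRedex r × plug c r ≡ t × lev c ≡ n

-- ll(T) = n : the infimum of such levels is n (the set is nonempty and has no smaller element)
LeastLevel : Term → ℕ → Set
LeastLevel t n = RedexAt t n × (∀ m → m < n → RedexAt t m → ⊥)

data StepIn : Ctx → Term → Term → Set where
  step : ∀ c r r' → RootStep r r' → StepIn c (plug c r) (plug c r')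

_→!β_ : Term → Term → Set
t →!β u = ∃ λ c → StepIn c t u

_→ll_ : Term → Term → Set
t →ll u = ∃ λ c → StepIn c t u × LeastLevel t (lev c)

_→¬ll_ : Term → Term → Set
t →¬ll u = ∃ λ c → StepIn c t u × ∃ λ m → m < lev c × LeastLevel t m

_→!β*_ : Term → Term → Set
_→!β*_ = Star _→!β_

_→ll*_ : Term → Term → Set
_→ll*_ = Star _→ll_

_→¬ll*_ : Term → Term → Set
_→¬ll*_ = Star _→¬ll_

-- Let t ⇛⟨≥ k ⟩ u be parallel
-- reduction contracting only redexes at level ≥ k.  Such a step splits into
-- steps at level exactly k followed by a ⇛⟨≥ k + 1 ⟩ step; iterating from
-- k = 0 while no redex exists below k turns the prefix into least-level steps
-- and leaves an internal parallel step, one whose redexes all lie above a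
-- level where the source still has a redex.  That redex survives the internal
-- step, so a least-level step after it fires at or below that level and is
-- absorbed into a single parallel step, which is factorised again.  Pushing
-- every least-level step to the front this way proves the theorem.
module Submission where

open import Defs
open import Data.Empty using (⊥; ⊥-elim)
open import Data.Nat using (ℕ; zero; suc; pred; _+_; _⊔_; _≤_; _<_; z≤n; s≤s)
open import Data.Nat.Properties
  using (≤-refl; ≤-trans; <-≤-trans; ≤-<-trans; ≮⇒≥; m<1+n⇒m≤n; m<n⇒m<1+n; n<1+n; pred-mono-≤; pred[n]≤n; +-suc; m≤m+n; m≤m⊔n; m≤n⊔m)
open import Data.Product using (∃; _×_; _,_; map₂)
open import Data.Sum using (_⊎_; inj₁; inj₂)
open import Data.Unit using (⊤; tt)
open import Function using (_∘_)
open import Relation.Nullary using (¬_; Dec; yes; no)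
open import Relation.Binary.PropositionalEquality
  using (_≡_; refl; sym; trans; cong; cong₂; module ≡-Reasoning) renaming (subst to transport)
open import Relation.Binary.Construct.Closure.ReflexiveTransitive using (Star; ε; _◅_; _◅◅_; gmap)

open ≡-Reasoning

-- Substitution algebra

extR-cong : ∀ {ρ ρ' : Ren} → (∀ i → ρ i ≡ ρ' i) → ∀ i → extR ρ i ≡ extR ρ' i
extR-cong h zero = refl
extR-cong h (suc i) = cong suc (h i)

rename-cong : ∀ {ρ ρ'} → (∀ i → ρ i ≡ ρ' i) → ∀ t → rename ρ t ≡ rename ρ' t
rename-cong h (var n) = cong var (h n)
rename-cong h (lam t) = cong lam (rename-cong (extR-cong h) t)
rename-cong h (app t s) = cong₂ app (rename-cong h t) (rename-cong h s)
rename-cong h (bang t) = cong bang (rename-cong h t)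

extS-cong : ∀ {σ τ : Sub} → (∀ i → σ i ≡ τ i) → ∀ i → extS σ i ≡ extS τ i
extS-cong h zero = refl
extS-cong h (suc i) = cong (rename suc) (h i)

subst-cong : ∀ {σ τ} → (∀ i → σ i ≡ τ i) → ∀ t → subst σ t ≡ subst τ t
subst-cong h (var n) = h n
subst-cong h (lam t) = cong lam (subst-cong (extS-cong h) t)
subst-cong h (app t s) = cong₂ app (subst-cong h t) (subst-cong h s)
subst-cong h (bang t) = cong bang (subst-cong h t)

rename-rename : ∀ ρ ρ' t → rename ρ (rename ρ' t) ≡ rename (ρ ∘ ρ') t
rename-rename ρ ρ' (var n) = refl
rename-rename ρ ρ' (lam t) =
  cong lam (trans (rename-rename (extR ρ) (extR ρ') t) (rename-cong (λ { zero → refl ; (suc i) → refl }) t))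
rename-rename ρ ρ' (app t s) = cong₂ app (rename-rename ρ ρ' t) (rename-rename ρ ρ' s)
rename-rename ρ ρ' (bang t) = cong bang (rename-rename ρ ρ' t)

rename-subst : ∀ ρ σ t → rename ρ (subst σ t) ≡ subst (rename ρ ∘ σ) t
rename-subst ρ σ (var n) = refl
rename-subst ρ σ (lam t) = cong lam (trans (rename-subst (extR ρ) (extS σ) t) (subst-cong ext t))
  where
  ext : ∀ i → rename (extR ρ) (extS σ i) ≡ extS (rename ρ ∘ σ) i
  ext zero = refl
  ext (suc i) = trans (rename-rename (extR ρ) suc (σ i)) (sym (rename-rename suc ρ (σ i)))
rename-subst ρ σ (app t s) = cong₂ app (rename-subst ρ σ t) (rename-subst ρ σ s)
rename-subst ρ σ (bang t) = cong bang (rename-subst ρ σ t)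

subst-rename : ∀ σ ρ t → subst σ (rename ρ t) ≡ subst (σ ∘ ρ) t
subst-rename σ ρ (var n) = refl
subst-rename σ ρ (lam t) =
  cong lam (trans (subst-rename (extS σ) (extR ρ) t) (subst-cong (λ { zero → refl ; (suc i) → refl }) t))
subst-rename σ ρ (app t s) = cong₂ app (subst-rename σ ρ t) (subst-rename σ ρ s)
subst-rename σ ρ (bang t) = cong bang (subst-rename σ ρ t)

subst-subst : ∀ σ τ t → subst σ (subst τ t) ≡ subst (subst σ ∘ τ) t
subst-subst σ τ (var n) = refl
subst-subst σ τ (lam t) = cong lam (trans (subst-subst (extS σ) (extS τ) t) (subst-cong ext t))
  where
  ext : ∀ i → subst (extS σ) (extS τ i) ≡ extS (subst σ ∘ τ) i
  ext zero = refl
  ext (suc i) = trans (subst-rename (extS σ) suc (τ i)) (sym (rename-subst suc σ (τ i)))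
subst-subst σ τ (app t s) = cong₂ app (subst-subst σ τ t) (subst-subst σ τ s)
subst-subst σ τ (bang t) = cong bang (subst-subst σ τ t)

subst-var : ∀ t → subst var t ≡ t
subst-var (var n) = refl
subst-var (lam t) = cong lam (trans (subst-cong (λ { zero → refl ; (suc i) → refl }) t) (subst-var t))
subst-var (app t s) = cong₂ app (subst-var t) (subst-var s)
subst-var (bang t) = cong bang (subst-var t)

rename-[/0] : ∀ ρ t s → rename ρ (t [ s /0]) ≡ rename (extR ρ) t [ rename ρ s /0]
rename-[/0] ρ t s = begin
  rename ρ (subst (single s) t)                   ≡⟨ rename-subst ρ (single s) t ⟩
  subst (rename ρ ∘ single s) t                   ≡⟨ subst-cong (λ { zero → refl ; (suc i) → refl }) t ⟩
  subst (single (rename ρ s) ∘ extR ρ) t          ≡⟨ subst-rename (single (rename ρ s)) (extR ρ) t ⟨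
  rename (extR ρ) t [ rename ρ s /0]              ∎

subst-[/0] : ∀ σ t s → subst σ (t [ s /0]) ≡ subst (extS σ) t [ subst σ s /0]
subst-[/0] σ t s = begin
  subst σ (subst (single s) t)                    ≡⟨ subst-subst σ (single s) t ⟩
  subst (subst σ ∘ single s) t                    ≡⟨ subst-cong ext t ⟩
  subst (subst (single (subst σ s)) ∘ extS σ) t   ≡⟨ subst-subst (single (subst σ s)) (extS σ) t ⟨
  subst (extS σ) t [ subst σ s /0]                ∎
  where
  ext : ∀ i → subst σ (single s i) ≡ subst (single (subst σ s)) (extS σ i)
  ext zero = refl
  ext (suc i) = sym (trans (subst-rename (single (subst σ s)) suc (σ i)) (subst-var (σ i)))

substSurface : Sub → Sub → Term → Term
substSurface σ ρ (var n) = σ n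
substSurface σ ρ (lam t) = lam (substSurface (extS σ) (extS ρ) t)
substSurface σ ρ (app t s) = app (substSurface σ ρ t) (substSurface σ ρ s)
substSurface σ ρ (bang t) = bang (substSurface ρ ρ t)

substSurface-self : ∀ σ t → substSurface σ σ t ≡ subst σ t
substSurface-self σ (var n) = refl
substSurface-self σ (lam t) = cong lam (substSurface-self (extS σ) t)
substSurface-self σ (app t s) = cong₂ app (substSurface-self σ t) (substSurface-self σ s)
substSurface-self σ (bang t) = cong bang (substSurface-self σ t)

bangDepth : Term → ℕ
bangDepth (var n) = 0
bangDepth (lam t) = bangDepth t
bangDepth (app t s) = bangDepth t ⊔ bangDepth s
bangDepth (bang t) = suc (bangDepth t)

-- Steps at a given level

infix 4 _⟶⟨_⟩_ _⟶⟨_⟩*_ _⟶⟨≥_⟩_ _⟶⟨≥_⟩*_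

data _⟶⟨_⟩_ : Term → ℕ → Term → Set where
  β      : ∀ t s → app (lam t) (bang s) ⟶⟨ 0 ⟩ t [ s /0]
  ξ-lam  : ∀ {k t t'} → t ⟶⟨ k ⟩ t' → lam t ⟶⟨ k ⟩ lam t'
  ξ-appL : ∀ {k t t' s} → t ⟶⟨ k ⟩ t' → app t s ⟶⟨ k ⟩ app t' s
  ξ-appR : ∀ {k t s s'} → s ⟶⟨ k ⟩ s' → app t s ⟶⟨ k ⟩ app t s'
  ξ-bang : ∀ {k t t'} → t ⟶⟨ k ⟩ t' → bang t ⟶⟨ suc k ⟩ bang t'

_⟶⟨_⟩*_ : Term → ℕ → Term → Set
t ⟶⟨ k ⟩* u = Star (_⟶⟨ k ⟩_) t u

_⟶⟨≥_⟩_ : Term → ℕ → Term → Set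
t ⟶⟨≥ k ⟩ u = ∃ λ j → k ≤ j × t ⟶⟨ j ⟩ u

_⟶⟨≥_⟩*_ : Term → ℕ → Term → Set
t ⟶⟨≥ k ⟩* u = Star (_⟶⟨≥ k ⟩_) t u

stepIn⇒⟶ : ∀ {c t u} → StepIn c t u → t ⟶⟨ lev c ⟩ u
stepIn⇒⟶ (step c _ _ (!β a b)) = plugged c
  where
  plugged : ∀ c → plug c (app (lam a) (bang b)) ⟶⟨ lev c ⟩ plug c (a [ b /0])
  plugged hole = β a b
  plugged (lamC c) = ξ-lam (plugged c)
  plugged (appR t c) = ξ-appR (plugged c)
  plugged (appL c t) = ξ-appL (plugged c)
  plugged (bangC c) = ξ-bang (plugged c)

⟶⇒stepIn : ∀ {k t u} → t ⟶⟨ k ⟩ u → ∃ λ c → StepIn c t u × lev c ≡ k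
⟶⇒stepIn (β t s) = hole , step hole _ _ (!β t s) , refl
⟶⇒stepIn (ξ-lam p) with ⟶⇒stepIn p
... | c , step c r r' rs , e = lamC c , step (lamC c) r r' rs , e
⟶⇒stepIn {t = app _ s} (ξ-appL p) with ⟶⇒stepIn p
... | c , step c r r' rs , e = appL c s , step (appL c s) r r' rs , e
⟶⇒stepIn {t = app t _} (ξ-appR p) with ⟶⇒stepIn p
... | c , step c r r' rs , e = appR t c , step (appR t c) r r' rs , e
⟶⇒stepIn (ξ-bang p) with ⟶⇒stepIn p
... | c , step c r r' rs , e = bangC c , step (bangC c) r r' rs , cong suc e

⟶-rename : ∀ {k t u} ρ → t ⟶⟨ k ⟩ u → rename ρ t ⟶⟨ k ⟩ rename ρ u
⟶-rename ρ (β t s) =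
  transport (rename ρ (app (lam t) (bang s)) ⟶⟨ 0 ⟩_) (sym (rename-[/0] ρ t s)) (β _ _)
⟶-rename ρ (ξ-lam p) = ξ-lam (⟶-rename (extR ρ) p)
⟶-rename ρ (ξ-appL p) = ξ-appL (⟶-rename ρ p)
⟶-rename ρ (ξ-appR p) = ξ-appR (⟶-rename ρ p)
⟶-rename ρ (ξ-bang p) = ξ-bang (⟶-rename ρ p)

⟶*-app : ∀ {k t t' s s'} → t ⟶⟨ k ⟩* t' → s ⟶⟨ k ⟩* s' → app t s ⟶⟨ k ⟩* app t' s'
⟶*-app p q = gmap (λ x → app x _) ξ-appL p ◅◅ gmap (app _) ξ-appR q

⟶≥*-lift : ∀ {k t u} (f : Term → Term) → (∀ {j x y} → x ⟶⟨ j ⟩ y → f x ⟶⟨ j ⟩ f y) →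
           t ⟶⟨≥ k ⟩* u → f t ⟶⟨≥ k ⟩* f u
⟶≥*-lift f g = gmap f (map₂ (map₂ g))

⟶≥*-bang : ∀ {k t u} → t ⟶⟨≥ pred k ⟩* u → bang t ⟶⟨≥ k ⟩* bang u
⟶≥*-bang = gmap bang (λ (j , k-1≤j , p) → suc j , ≤-suc-pred k-1≤j , ξ-bang p)
  where
  ≤-suc-pred : ∀ {k j} → pred k ≤ j → k ≤ suc j
  ≤-suc-pred {zero} _ = z≤n
  ≤-suc-pred {suc k} k≤j = s≤s k≤j

-- Redexes below a level

redexAt-lam : ∀ {t m} → RedexAt t m → RedexAt (lam t) m
redexAt-lam (c , r , isr , refl , refl) = lamC c , r , isr , refl , refl

redexAt-appL : ∀ {t s m} → RedexAt t m → RedexAt (app t s) m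
redexAt-appL {s = s} (c , r , isr , refl , refl) = appL c s , r , isr , refl , refl

redexAt-appR : ∀ {t s m} → RedexAt s m → RedexAt (app t s) m
redexAt-appR {t = t} (c , r , isr , refl , refl) = appR t c , r , isr , refl , refl

redexAt-bang : ∀ {t m} → RedexAt t m → RedexAt (bang t) (suc m)
redexAt-bang (c , r , isr , refl , refl) = bangC c , r , isr , refl , refl

stepIn⇒redexAt : ∀ {c t u} → StepIn c t u → RedexAt t (lev c)
stepIn⇒redexAt (step c r r' rs) = c , r , (r' , rs) , refl , refl

redex? : ∀ t s → Dec (IsRedex (app t s))
redex? (lam t) (bang s) = yes (_ , !β t s)
redex? (lam _) (var _) = no λ ()
redex? (lam _) (lam _) = no λ ()
redex? (lam _) (app _ _) = no λ ()
redex? (var _) _ = no λ ()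
redex? (app _ _) _ = no λ ()
redex? (bang _) _ = no λ ()

NoRedexBelow : ℕ → Term → Set
NoRedexBelow zero _ = ⊤
NoRedexBelow (suc k) (var _) = ⊤
NoRedexBelow (suc k) (lam t) = NoRedexBelow (suc k) t
NoRedexBelow (suc k) (app t s) = ¬ IsRedex (app t s) × NoRedexBelow (suc k) t × NoRedexBelow (suc k) s
NoRedexBelow (suc k) (bang t) = NoRedexBelow k t

RedexBelow : ℕ → Term → Set
RedexBelow k t = ∃ λ m → m < k × RedexAt t m

RedexAtMost : ℕ → Term → Set
RedexAtMost k t = ∃ λ m → m ≤ k × RedexAt t m

noRedexBelow-¬redexAt : ∀ {k t m} → NoRedexBelow k t → RedexAt t m → ¬ m < k
noRedexBelow-¬redexAt none (c , r , isr , refl , refl) = noRedexInside c isr none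
  where
  noRedexInside : ∀ {k} c {r} → IsRedex r → NoRedexBelow k (plug c r) → ¬ lev c < k
  noRedexInside {suc k} hole (_ , !β _ _) (¬r , _) _ = ¬r (_ , !β _ _)
  noRedexInside {suc k} (lamC c) isr none = noRedexInside c isr none
  noRedexInside {suc k} (appR t c) isr (_ , _ , none) = noRedexInside c isr none
  noRedexInside {suc k} (appL c t) isr (_ , none , _) = noRedexInside c isr none
  noRedexInside {suc k} (bangC c) isr none (s≤s lt) = noRedexInside c isr none lt

redexBelow? : ∀ k t → RedexBelow k t ⊎ NoRedexBelow k t
redexBelow? zero t = inj₂ tt
redexBelow? (suc k) (var n) = inj₂ tt
redexBelow? (suc k) (lam t) with redexBelow? (suc k) t
... | inj₁ (m , m<k , r) = inj₁ (m , m<k , redexAt-lam r)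
... | inj₂ none = inj₂ none
redexBelow? (suc k) (bang t) with redexBelow? k t
... | inj₁ (m , m<k , r) = inj₁ (suc m , s≤s m<k , redexAt-bang r)
... | inj₂ none = inj₂ none
redexBelow? (suc k) (app t s) with redex? t s | redexBelow? (suc k) t | redexBelow? (suc k) s
... | yes isr | _ | _ = inj₁ (0 , s≤s z≤n , hole , app t s , isr , refl , refl)
... | no _ | inj₁ (m , m<k , r) | _ = inj₁ (m , m<k , redexAt-appL r)
... | no _ | inj₂ _ | inj₁ (m , m<k , r) = inj₁ (m , m<k , redexAt-appR r)
... | no ¬isr | inj₂ nt | inj₂ ns = inj₂ (¬isr , nt , ns)

leastLevel-or-noRedexBelow : ∀ n t → (∃ λ m → m < n × LeastLevel t m) ⊎ NoRedexBelow n t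
leastLevel-or-noRedexBelow zero t = inj₂ tt
leastLevel-or-noRedexBelow (suc n) t with leastLevel-or-noRedexBelow n t
... | inj₁ (m , m<n , ll) = inj₁ (m , m<n⇒m<1+n m<n , ll)
... | inj₂ noneBelowN with redexBelow? (suc n) t
...   | inj₂ none = inj₂ none
...   | inj₁ (m , m<1+n , r) = inj₁ (m , m<1+n , r , minimal)
  where
  minimal : ∀ m' → m' < m → RedexAt t m' → ⊥
  minimal m' m'<m r' = noRedexBelow-¬redexAt noneBelowN r' (<-≤-trans m'<m (m<1+n⇒m≤n m<1+n))

leastLevel : ∀ {t m} → RedexAt t m → ∃ λ l → l ≤ m × LeastLevel t l
leastLevel {t} {m} r with leastLevel-or-noRedexBelow (suc m) t
... | inj₁ (l , l<1+m , ll) = l , m<1+n⇒m≤n l<1+m , ll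
... | inj₂ none = ⊥-elim (noRedexBelow-¬redexAt none r (n<1+n m))

redex-⟶-forward : ∀ {j t s u} → app t s ⟶⟨ suc j ⟩ u → IsRedex (app t s) → IsRedex u
redex-⟶-forward (ξ-appL (ξ-lam _)) (_ , !β _ _) = _ , !β _ _
redex-⟶-forward (ξ-appR (ξ-bang _)) (_ , !β _ _) = _ , !β _ _

redex-⟶-backward : ∀ {j t s u} → u ⟶⟨ suc j ⟩ app t s → IsRedex (app t s) → IsRedex u
redex-⟶-backward (ξ-appL (ξ-lam _)) (_ , !β _ _) = _ , !β _ _
redex-⟶-backward (ξ-appR (ξ-bang _)) (_ , !β _ _) = _ , !β _ _

noRedexBelow-⟶ : ∀ {k j t u} → k ≤ j → t ⟶⟨ j ⟩ u → NoRedexBelow k t → NoRedexBelow k u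
noRedexBelow-⟶ {zero} _ _ _ = tt
noRedexBelow-⟶ {suc k} k≤j (ξ-lam p) none = noRedexBelow-⟶ k≤j p none
noRedexBelow-⟶ {suc k} k≤j@(s≤s _) p@(ξ-appL q) (¬r , nt , ns) =
  ¬r ∘ redex-⟶-backward p , noRedexBelow-⟶ k≤j q nt , ns
noRedexBelow-⟶ {suc k} k≤j@(s≤s _) p@(ξ-appR q) (¬r , nt , ns) =
  ¬r ∘ redex-⟶-backward p , nt , noRedexBelow-⟶ k≤j q ns
noRedexBelow-⟶ {suc k} (s≤s k≤j) (ξ-bang p) none = noRedexBelow-⟶ k≤j p none

noRedexBelow-⟵ : ∀ {k j t u} → k ≤ j → t ⟶⟨ j ⟩ u → NoRedexBelow k u → NoRedexBelow k t
noRedexBelow-⟵ {zero} _ _ _ = tt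
noRedexBelow-⟵ {suc k} k≤j (ξ-lam p) none = noRedexBelow-⟵ k≤j p none
noRedexBelow-⟵ {suc k} k≤j@(s≤s _) p@(ξ-appL q) (¬r , nt , ns) =
  ¬r ∘ redex-⟶-forward p , noRedexBelow-⟵ k≤j q nt , ns
noRedexBelow-⟵ {suc k} k≤j@(s≤s _) p@(ξ-appR q) (¬r , nt , ns) =
  ¬r ∘ redex-⟶-forward p , nt , noRedexBelow-⟵ k≤j q ns
noRedexBelow-⟵ {suc k} (s≤s k≤j) (ξ-bang p) none = noRedexBelow-⟵ k≤j p none

redexAtMost-⟶≥* : ∀ {k t u} → RedexAtMost k t → t ⟶⟨≥ suc k ⟩* u → RedexAtMost k u
redexAtMost-⟶≥* r ε = r
redexAtMost-⟶≥* (m , m≤k , r) ((j , k<j , p) ◅ ps) with redexBelow? (suc m) _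
... | inj₁ (m' , m'<1+m , r') = redexAtMost-⟶≥* (m' , ≤-trans (m<1+n⇒m≤n m'<1+m) m≤k , r') ps
... | inj₂ none =
  ⊥-elim (noRedexBelow-¬redexAt (noRedexBelow-⟵ (≤-trans (s≤s m≤k) k<j) p none) r (n<1+n m))

-- Parallel reduction above a level

infix 4 _⇛⟨≥_⟩_

data _⇛⟨≥_⟩_ : Term → ℕ → Term → Set where
  ⇛var  : ∀ {k n} → var n ⇛⟨≥ k ⟩ var n
  ⇛lam  : ∀ {k t t'} → t ⇛⟨≥ k ⟩ t' → lam t ⇛⟨≥ k ⟩ lam t'
  ⇛app  : ∀ {k t t' s s'} → t ⇛⟨≥ k ⟩ t' → s ⇛⟨≥ k ⟩ s' → app t s ⇛⟨≥ k ⟩ app t' s'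
  ⇛bang : ∀ {k t t'} → t ⇛⟨≥ pred k ⟩ t' → bang t ⇛⟨≥ k ⟩ bang t'
  ⇛β    : ∀ {t t' s s'} → t ⇛⟨≥ 0 ⟩ t' → s ⇛⟨≥ 0 ⟩ s' → app (lam t) (bang s) ⇛⟨≥ 0 ⟩ t' [ s' /0]

⇛-refl : ∀ {k} t → t ⇛⟨≥ k ⟩ t
⇛-refl (var n) = ⇛var
⇛-refl (lam t) = ⇛lam (⇛-refl t)
⇛-refl (app t s) = ⇛app (⇛-refl t) (⇛-refl s)
⇛-refl (bang t) = ⇛bang (⇛-refl t)

⇛-mono : ∀ {j k t u} → j ≤ k → t ⇛⟨≥ k ⟩ u → t ⇛⟨≥ j ⟩ u
⇛-mono j≤k ⇛var = ⇛var
⇛-mono j≤k (⇛lam p) = ⇛lam (⇛-mono j≤k p)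
⇛-mono j≤k (⇛app p q) = ⇛app (⇛-mono j≤k p) (⇛-mono j≤k q)
⇛-mono j≤k (⇛bang p) = ⇛bang (⇛-mono (pred-mono-≤ j≤k) p)
⇛-mono z≤n (⇛β p q) = ⇛β p q

⟶⇒⇛ : ∀ {k t u} → t ⟶⟨ k ⟩ u → t ⇛⟨≥ k ⟩ u
⟶⇒⇛ (β t s) = ⇛β (⇛-refl t) (⇛-refl s)
⟶⇒⇛ (ξ-lam p) = ⇛lam (⟶⇒⇛ p)
⟶⇒⇛ (ξ-appL {s = s} p) = ⇛app (⟶⇒⇛ p) (⇛-refl s)
⟶⇒⇛ (ξ-appR {t = t} p) = ⇛app (⇛-refl t) (⟶⇒⇛ p)
⟶⇒⇛ (ξ-bang p) = ⇛bang (⟶⇒⇛ p)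

⇛⇒⟶≥* : ∀ {k t u} → t ⇛⟨≥ k ⟩ u → t ⟶⟨≥ k ⟩* u
⇛⇒⟶≥* ⇛var = ε
⇛⇒⟶≥* (⇛lam p) = ⟶≥*-lift lam ξ-lam (⇛⇒⟶≥* p)
⇛⇒⟶≥* (⇛app p q) = ⟶≥*-lift (λ x → app x _) ξ-appL (⇛⇒⟶≥* p) ◅◅ ⟶≥*-lift (app _) ξ-appR (⇛⇒⟶≥* q)
⇛⇒⟶≥* (⇛bang p) = ⟶≥*-bang (⇛⇒⟶≥* p)
⇛⇒⟶≥* (⇛β {t' = t'} {s' = s'} p q) =
  ⟶≥*-lift (λ x → app (lam x) _) (ξ-appL ∘ ξ-lam) (⇛⇒⟶≥* p)
  ◅◅ ⟶≥*-lift (app (lam t')) ξ-appR (⟶≥*-bang (⇛⇒⟶≥* q))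
  ◅◅ (0 , z≤n , β t' s') ◅ ε

⇛-rename : ∀ {k t u} ρ → t ⇛⟨≥ k ⟩ u → rename ρ t ⇛⟨≥ k ⟩ rename ρ u
⇛-rename ρ ⇛var = ⇛var
⇛-rename ρ (⇛lam p) = ⇛lam (⇛-rename (extR ρ) p)
⇛-rename ρ (⇛app p q) = ⇛app (⇛-rename ρ p) (⇛-rename ρ q)
⇛-rename ρ (⇛bang p) = ⇛bang (⇛-rename ρ p)
⇛-rename ρ (⇛β {t' = t'} {s' = s'} p q) =
  transport (_ ⇛⟨≥ 0 ⟩_) (sym (rename-[/0] ρ t' s')) (⇛β (⇛-rename (extR ρ) p) (⇛-rename ρ q))

⇛-extS : ∀ {k σ τ} → (∀ i → σ i ⇛⟨≥ k ⟩ τ i) → ∀ i → extS σ i ⇛⟨≥ k ⟩ extS τ i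
⇛-extS h zero = ⇛var
⇛-extS h (suc i) = ⇛-rename suc (h i)

⇛-single : ∀ {k s s'} → s ⇛⟨≥ k ⟩ s' → ∀ i → single s i ⇛⟨≥ k ⟩ single s' i
⇛-single p zero = p
⇛-single p (suc i) = ⇛var

⇛-substSurface : ∀ {k t u} σ ρ τ → t ⇛⟨≥ k ⟩ u →
                 (∀ i → σ i ⇛⟨≥ k ⟩ τ i) → (∀ i → ρ i ⇛⟨≥ pred k ⟩ τ i) →
                 substSurface σ ρ t ⇛⟨≥ k ⟩ subst τ u
⇛-substSurface σ ρ τ ⇛var hσ hρ = hσ _
⇛-substSurface σ ρ τ (⇛lam p) hσ hρ = ⇛lam (⇛-substSurface (extS σ) (extS ρ) (extS τ) p (⇛-extS hσ) (⇛-extS hρ))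
⇛-substSurface σ ρ τ (⇛app p q) hσ hρ = ⇛app (⇛-substSurface σ ρ τ p hσ hρ) (⇛-substSurface σ ρ τ q hσ hρ)
⇛-substSurface σ ρ τ (⇛bang p) hσ hρ = ⇛bang (⇛-substSurface ρ ρ τ p hρ (⇛-mono pred[n]≤n ∘ hρ))
⇛-substSurface σ ρ τ (⇛β {t' = t'} {s' = s'} p q) hσ hρ =
  transport (_ ⇛⟨≥ 0 ⟩_) (sym (subst-[/0] τ t' s'))
    (⇛β (⇛-substSurface (extS σ) (extS ρ) (extS τ) p (⇛-extS hσ) (⇛-extS hρ)) (⇛-substSurface ρ ρ τ q hρ hρ))

substSurface-⟶* : ∀ {k σ σ'} ρ → (∀ i → σ i ⟶⟨ k ⟩* σ' i) →
                  ∀ t → substSurface σ ρ t ⟶⟨ k ⟩* substSurface σ' ρ t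
substSurface-⟶* ρ h (var n) = h n
substSurface-⟶* {σ = σ} {σ'} ρ h (lam t) = gmap lam ξ-lam (substSurface-⟶* (extS ρ) ext t)
  where
  ext : ∀ i → extS σ i ⟶⟨ _ ⟩* extS σ' i
  ext zero = ε
  ext (suc i) = gmap (rename suc) (⟶-rename suc) (h i)
substSurface-⟶* ρ h (app t s) = ⟶*-app (substSurface-⟶* ρ h t) (substSurface-⟶* ρ h s)
substSurface-⟶* ρ h (bang t) = ε

⇛-split : ∀ {k t u} → t ⇛⟨≥ k ⟩ u → ∃ λ v → t ⟶⟨ k ⟩* v × v ⇛⟨≥ suc k ⟩ u
⇛-split ⇛var = _ , ε , ⇛var
⇛-split (⇛lam p) with ⇛-split p
... | v , steps , p' = lam v , gmap lam ξ-lam steps , ⇛lam p'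
⇛-split (⇛app p q) with ⇛-split p | ⇛-split q
... | v , steps , p' | w , steps' , q' = app v w , ⟶*-app steps steps' , ⇛app p' q'
⇛-split {zero} (⇛bang p) = _ , ε , ⇛bang p
⇛-split {suc k} (⇛bang p) with ⇛-split p
... | v , steps , p' = bang v , gmap bang ξ-bang steps , ⇛bang p'
⇛-split (⇛β {t = t} {s = s} {s' = s'} p q) with ⇛-split p | ⇛-split q
... | v , steps , p' | w , steps' , q' =
  substSurface (single w) (single s) v ,
  gmap (λ x → app (lam x) (bang s)) (ξ-appL ∘ ξ-lam) steps
    ◅◅ transport (app (lam v) (bang s) ⟶⟨ 0 ⟩_) (sym (substSurface-self (single s) v)) (β v s)
    ◅ substSurface-⟶* (single s) (λ { zero → steps' ; (suc i) → ε }) v ,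
  ⇛-substSurface (single w) (single s) (single s') p' (⇛-single q') (⇛-single q)

⇛-beyond-bangDepth⇒≡ : ∀ {k t u} → bangDepth u < k → t ⇛⟨≥ k ⟩ u → t ≡ u
⇛-beyond-bangDepth⇒≡ lt ⇛var = refl
⇛-beyond-bangDepth⇒≡ lt (⇛lam p) = cong lam (⇛-beyond-bangDepth⇒≡ lt p)
⇛-beyond-bangDepth⇒≡ {u = app t' s'} lt (⇛app p q) =
  cong₂ app (⇛-beyond-bangDepth⇒≡ (≤-<-trans (m≤m⊔n (bangDepth t') (bangDepth s')) lt) p)
            (⇛-beyond-bangDepth⇒≡ (≤-<-trans (m≤n⊔m (bangDepth t') (bangDepth s')) lt) q)
⇛-beyond-bangDepth⇒≡ (s≤s lt) (⇛bang p) = cong bang (⇛-beyond-bangDepth⇒≡ lt p)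

⇛-append : ∀ {k j t u v} → t ⇛⟨≥ suc k ⟩ u → u ⟶⟨ j ⟩ v → j ≤ k → t ⇛⟨≥ 0 ⟩ v
⇛-append (⇛app (⇛lam p) (⇛bang q)) (β _ _) _ = ⇛β (⇛-mono z≤n p) (⇛-mono z≤n q)
⇛-append (⇛lam p) (ξ-lam s) j≤k = ⇛lam (⇛-append p s j≤k)
⇛-append (⇛app p q) (ξ-appL s) j≤k = ⇛app (⇛-append p s j≤k) (⇛-mono z≤n q)
⇛-append (⇛app p q) (ξ-appR s) j≤k = ⇛app (⇛-mono z≤n p) (⇛-append q s j≤k)
⇛-append (⇛bang p) (ξ-bang s) (s≤s j≤k) = ⇛bang (⇛-append p s j≤k)

-- Least-level and internal reduction

⟶⇒ll : ∀ {k t u} → NoRedexBelow k t → t ⟶⟨ k ⟩ u → t →ll u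
⟶⇒ll none p with ⟶⇒stepIn p
... | c , s , refl = c , s , stepIn⇒redexAt s , λ m m<k r → noRedexBelow-¬redexAt none r m<k

⟶*⇒ll* : ∀ {k t u} → NoRedexBelow k t → t ⟶⟨ k ⟩* u → t →ll* u × NoRedexBelow k u
⟶*⇒ll* none ε = ε , none
⟶*⇒ll* none (p ◅ ps) with ⟶*⇒ll* (noRedexBelow-⟶ ≤-refl p none) ps
... | lls , none' = ⟶⇒ll none p ◅ lls , none'

⟶≥*⇒¬ll* : ∀ {k t u} → RedexAtMost k t → t ⟶⟨≥ suc k ⟩* u → t →¬ll* u
⟶≥*⇒¬ll* r ε = ε
⟶≥*⇒¬ll* r@(m , m≤k , rm) ((j , k<j , p) ◅ ps) with leastLevel rm | ⟶⇒stepIn p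
... | l , l≤m , ll | c , s , refl =
  (c , s , l , ≤-<-trans (≤-trans l≤m m≤k) k<j , ll) ◅ ⟶≥*⇒¬ll* (redexAtMost-⟶≥* r ((j , k<j , p) ◅ ε)) ps

InternalPar : Term → Term → Set
InternalPar t u = t ≡ u ⊎ ∃ λ k → t ⇛⟨≥ suc k ⟩ u × RedexAtMost k t

internalPar⇒¬ll* : ∀ {t u} → InternalPar t u → t →¬ll* u
internalPar⇒¬ll* (inj₁ refl) = ε
internalPar⇒¬ll* (inj₂ (k , p , r)) = ⟶≥*⇒¬ll* r (⇛⇒⟶≥* p)

⇛-factorise-from : ∀ n k {t u} → bangDepth u < n + k → t ⇛⟨≥ k ⟩ u → NoRedexBelow k t →
                   ∃ λ v → t →ll* v × InternalPar v u
⇛-factorise-from zero k lt p none = _ , ε , inj₁ (⇛-beyond-bangDepth⇒≡ lt p)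
⇛-factorise-from (suc n) k {u = u} lt p none with ⇛-split p
... | v , steps , p' with ⟶*⇒ll* none steps
... | lls , noneV with redexBelow? (suc k) v
... | inj₁ (m , m<1+k , r) = v , lls , inj₂ (k , p' , m , m<1+n⇒m≤n m<1+k , r)
... | inj₂ noneV' with ⇛-factorise-from n (suc k) (transport (bangDepth u <_) (sym (+-suc n k)) lt) p' noneV'
... | w , lls' , int = w , lls ◅◅ lls' , int

⇛-factorise : ∀ {t u} → t ⇛⟨≥ 0 ⟩ u → ∃ λ v → t →ll* v × InternalPar v u
⇛-factorise {u = u} p = ⇛-factorise-from (suc (bangDepth u)) 0 (s≤s (m≤m+n (bangDepth u) 0)) p tt

-- The internal step keeps a redex at level ≤ k, so the least-level step that follows
-- fires at level ≤ k and can be absorbed into the parallel step.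
internalPar-ll-swap : ∀ {t u v} → InternalPar t u → u →ll v → ∃ λ w → t →ll* w × InternalPar w v
internalPar-ll-swap (inj₁ refl) s = _ , s ◅ ε , inj₁ refl
internalPar-ll-swap (inj₂ (k , p , r)) (c , s , _ , minimal) with redexAtMost-⟶≥* r (⇛⇒⟶≥* p)
... | m , m≤k , rm = ⇛-factorise (⇛-append p (stepIn⇒⟶ s) (≤-trans (≮⇒≥ λ m<c → minimal m m<c rm) m≤k))

internalPar-ll*-swap : ∀ {t u v} → InternalPar t u → u →ll* v → ∃ λ w → t →ll* w × InternalPar w v
internalPar-ll*-swap int ε = _ , ε , int
internalPar-ll*-swap int (s ◅ ss) with internalPar-ll-swap int s
... | w , lls , int' with internalPar-ll*-swap int' ss
... | w' , lls' , int'' = w' , lls ◅◅ lls' , int''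

corollary1 : ∀ (T S : Term) → T →!β* S → ∃ λ U → (T →ll* U) × (U →¬ll* S)
corollary1 T .T ε = T , ε , ε
corollary1 T S ((c , s) ◅ ss) with corollary1 _ S ss
... | U , lls , ¬lls with ⇛-factorise (⇛-mono z≤n (⟶⇒⇛ (stepIn⇒⟶ s)))
... | V , lls₀ , int with internalPar-ll*-swap int lls
... | W , lls₁ , int' = W , lls₀ ◅◅ lls₁ , internalPar⇒¬ll* int' ◅◅ ¬lls
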